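{- Let $k\ge 2$. For integers $j\ge1$ and $n\ge j$, let $h_k(j,n)$ denote the number of $k$-front noncrossing partitions of $[n]$ in which each of $1,2,\dots,j$ is a head. If $2\leq i\leq k$ and $n\ge i$, then $$h_k(i,n)= h_k(i-1,n) -(i-1)\,h_k(i-1,n-1).$$
   Context: A partition of $[n]$ is a set of pairwise disjoint nonempty blocks with union $[n]$. A head is the smallest element of a block. A front edge is a pair $(i,j)$, $i<j$, in the same block with $i$ the head of that block. A $k$-front crossing ($k\ge2$) is a pair of front edges $(i_1,j_1),(i_2,j_2)$ with $i_1<i_2<j_1<j_2$ and at least $k-2$ heads $h$ with $i_2<h<j_1$; a partition is $k$-front noncrossing if it has none. -}

module Defs where

open import Data.Nat using (ℕ; zero; suc; _+_; _∸_; _<ᵇ_; _≤ᵇ_)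
open import Data.Bool using (Bool; true; false; _∧_; _∨_; not; if_then_else_)
open import Data.Fin using (Fin; toℕ)
open import Data.List using (List; []; _∷_; map; concatMap; filter; length; allFin)
import Data.Bool.ListAction as L
open import Data.Bool.Properties using (T?)
open import Data.Fin.Properties using ()

-- Conventions: the ground set [n] = {1,…,n} is represented by Fin n,
-- element x : Fin n standing for toℕ x + 1 (order is preserved).
-- A partition of [n] is represented by its equivalence relation
-- "x and y lie in the same block", a Boolean relation R : Fin n → Fin n → Bool
-- that is reflexive, symmetric and transitive (blocks = equivalence classes;
-- this is a bijection between set partitions and equivalence relations).

Rel₂ : ℕ → Set
Rel₂ n = Fin n → Fin n → Bool

allᶠ : {n : ℕ} → (Fin n → Bool) → Bool
allᶠ {n} p = L.all p (allFin n)

anyᶠ : {n : ℕ} → (Fin n → Bool) → Bool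
anyᶠ {n} p = L.any p (allFin n)

countᶠ : {n : ℕ} → (Fin n → Bool) → ℕ
countᶠ {n} p = length (filter (λ x → T? (p x)) (allFin n))

_<ᶠ_ : {n : ℕ} → Fin n → Fin n → Bool
x <ᶠ y = toℕ x <ᵇ toℕ y

isEquivalence : {n : ℕ} → Rel₂ n → Bool
isEquivalence R =
  allᶠ (λ x → R x x) ∧
  allᶠ (λ x → allᶠ (λ y → not (R x y) ∨ R y x)) ∧
  allᶠ (λ x → allᶠ (λ y → allᶠ (λ z → not (R x y ∧ R y z) ∨ R x z)))

isHead : {n : ℕ} → Rel₂ n → Fin n → Bool
isHead R x = not (anyᶠ (λ y → (y <ᶠ x) ∧ R y x))

frontEdge : {n : ℕ} → Rel₂ n → Fin n → Fin n → Bool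
frontEdge R x y = (x <ᶠ y) ∧ R x y ∧ isHead R x

headsBetween : {n : ℕ} → Rel₂ n → Fin n → Fin n → ℕ
headsBetween R a b = countᶠ (λ h → (a <ᶠ h) ∧ (h <ᶠ b) ∧ isHead R h)

hasFrontCrossing : ℕ → {n : ℕ} → Rel₂ n → Bool
hasFrontCrossing k R =
  anyᶠ (λ i₁ → anyᶠ (λ j₁ → anyᶠ (λ i₂ → anyᶠ (λ j₂ →
    frontEdge R i₁ j₁ ∧ frontEdge R i₂ j₂ ∧
    (i₁ <ᶠ i₂) ∧ (i₂ <ᶠ j₁) ∧ (j₁ <ᶠ j₂) ∧
    ((k ∸ 2) ≤ᵇ headsBetween R i₂ j₁)))))

-- each of 1,…,j is a head (0-indexed: elements x with toℕ x < j)
firstAreHeads : ℕ → {n : ℕ} → Rel₂ n → Bool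
firstAreHeads j R = allᶠ (λ x → not (toℕ x <ᵇ j) ∨ isHead R x)

allFuns : {A : Set} → List A → (m : ℕ) → List (Fin m → A)
allFuns xs zero = (λ ()) ∷ []
allFuns xs (suc m) =
  concatMap (λ a → map (λ f → λ { Fin.zero → a ; (Fin.suc i) → f i }) (allFuns xs m)) xs

allRels : (n : ℕ) → List (Rel₂ n)
allRels n = allFuns (allFuns (true ∷ false ∷ []) n) n

h : ℕ → ℕ → ℕ → ℕ
h k j n = length (filter (λ R → T? (isEquivalence R ∧ not (hasFrontCrossing k R) ∧ firstAreHeads j R)) (allRels n))

-- Sort the k-front noncrossing partitions of [n] in which 1, …, i−1 are heads by whether
-- i is a head.  Those where it is are counted by h_k(i, n).  Otherwise i lies in the block
-- of exactly one j < i (its head, as all elements below i are heads), and deleting i is a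
-- bijection onto the partitions counted by h_k(i−1, n−1), the inverse putting i back into
-- the block of j.  Heads are unaffected, so the only new front edge (j, i) must be checked:
-- it cannot be the second edge of a crossing, since the first would end at a head below i,
-- and as the first edge it sees at most i − 3 < k − 2 heads strictly inside.  Summing over
-- the i − 1 choices of j gives h_k(i−1, n) = h_k(i, n) + (i−1) h_k(i−1, n−1).

module Submission where

open import Defs
open import Data.Nat using (ℕ; _≤_; _∸_)
open import Data.Integer using (ℤ; +_; _-_)
open import Relation.Binary.PropositionalEquality using (_≡_)

open import Data.Bool using (Bool; true; false; T; _∧_; _∨_; not)
open import Data.Bool.Properties using (T-∧; T?; ∧-assoc)
import Data.Bool.Properties as Bool
open import Data.Empty using (⊥-elim)
open import Data.Integer using (_⊖_)
open import Data.Fin using (Fin; zero; suc; toℕ; punchIn; punchOut; fromℕ<; _<_)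
open import Data.Fin.Properties
  using (toℕ-injective; <-cmp; punchInᵢ≢i; punchIn-punchOut; toℕ-fromℕ<; toℕ<n)
import Data.Fin.Properties as Fin
import Data.Integer.Properties as ℤ
open import Data.List using (List; []; _∷_; map; concatMap; filter; length; allFin; _++_)
open import Data.Nat.ListAction using (sum)
open import Data.List.Properties using (map-cong; map-tabulate; filter-++; filter-none; length-++)
open import Data.List.Membership.Propositional using (lose)
open import Data.List.Membership.Propositional.Properties using (∈-allFin)
import Data.List.Relation.Unary.All as All
open import Data.List.Relation.Unary.All.Properties using (all⁺; all⁻)
open import Data.List.Relation.Unary.Any using (satisfied)
open import Data.List.Relation.Unary.Any.Properties using (any⁺; any⁻)
import Data.Bool.ListAction as ListAction
open import Data.Nat using (zero; suc; _+_; _*_; z≤n; s≤s)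
import Data.Nat as ℕ
open import Data.Nat.Properties
  using (+-identityʳ; *-identityʳ; +-suc; +-commutativeSemigroup; ≤-reflexive; ≤-refl; n≮0;
         +-mono-≤; ≤-pred; ∸-+-assoc; <ᵇ⇒<; <⇒<ᵇ; ≤ᵇ⇒≤; n≤1+n; <⇒≱; ≤-trans; m∸n≤m; <⇒≤; ≤-<-trans;
         <-irrefl; m<n⇒m<1+n; n<1+n; m≤n⇒m<n∨m≡n; m≤n+m; m+n∸n≡m; module ≤-Reasoning)
open import Algebra.Properties.CommutativeSemigroup +-commutativeSemigroup
  using (interchange; x∙yz≈y∙xz)
open import Data.Product using (_×_; _,_; proj₁; proj₂; ∃)
open import Data.Sum using (inj₁; inj₂)
open import Function using (_∘_; id; Equivalence)
open import Relation.Binary.PropositionalEquality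
  using (refl; sym; trans; cong; cong₂; subst; _≢_; module ≡-Reasoning)
open import Relation.Binary.Structures using (IsEquivalence)
import Relation.Binary.Construct.On as On
open import Relation.Binary.Definitions using (tri<; tri≈; tri>)
open import Relation.Nullary using (¬_; yes; no)
open import Relation.Nullary.Decidable using (⌊_⌋; toWitness; fromWitness)

private
  variable
    A B : Set
    m n : ℕ

-- Booleans and counting

⟦_⟧ : Bool → ℕ
⟦ true ⟧ = 1
⟦ false ⟧ = 0

⟦⟧≡1 : ∀ a → T a → ⟦ a ⟧ ≡ 1
⟦⟧≡1 true _ = refl

⟦⟧≡0 : ∀ a → ¬ T a → ⟦ a ⟧ ≡ 0
⟦⟧≡0 true ¬a = ⊥-elim (¬a _)
⟦⟧≡0 false _ = refl

T-∧⁻ : ∀ a {b} → T (a ∧ b) → T a × T b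
T-∧⁻ _ = Equivalence.to T-∧

T-∧⁺ : ∀ a {b} → T a → T b → T (a ∧ b)
T-∧⁺ _ ta tb = Equivalence.from T-∧ (ta , tb)

T-not⁻ : ∀ a → T (not a) → ¬ T a
T-not⁻ false _ ()

T-not⁺ : ∀ a → ¬ T a → T (not a)
T-not⁺ true ¬a = ¬a _
T-not⁺ false _ = _

T-⇒⁻ : ∀ a {b} → T (not a ∨ b) → T a → T b
T-⇒⁻ true tb _ = tb

T-⇒⁺ : ∀ a {b} → (T a → T b) → T (not a ∨ b)
T-⇒⁺ true f = f _
T-⇒⁺ false _ = _

T-ext : ∀ {a b} → (T a → T b) → (T b → T a) → a ≡ b
T-ext {false} {false} _ _ = refl
T-ext {false} {true} _ g = ⊥-elim (g _)
T-ext {true} {false} f _ = ⊥-elim (f _)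
T-ext {true} {true} _ _ = refl

∑ : List A → (A → ℕ) → ℕ
∑ xs f = sum (map f xs)

count : (A → Bool) → List A → ℕ
count p xs = length (filter (T? ∘ p) xs)

∑-cong : ∀ {f g : A → ℕ} → (∀ x → f x ≡ g x) → ∀ xs → ∑ xs f ≡ ∑ xs g
∑-cong f≗g xs = cong sum (map-cong f≗g xs)

∑-zero : ∀ (xs : List A) → ∑ xs (λ _ → 0) ≡ 0
∑-zero [] = refl
∑-zero (_ ∷ xs) = ∑-zero xs

∑-+ : ∀ (f g : A → ℕ) xs → ∑ xs (λ x → f x + g x) ≡ ∑ xs f + ∑ xs g
∑-+ f g [] = refl
∑-+ f g (x ∷ xs) =
  trans (cong (_+_ (f x + g x)) (∑-+ f g xs)) (interchange (f x) (g x) (∑ xs f) (∑ xs g))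

∑-swap : ∀ (xs : List A) (ys : List B) (F : A → B → ℕ) →
         ∑ xs (λ x → ∑ ys (F x)) ≡ ∑ ys (λ y → ∑ xs (λ x → F x y))
∑-swap [] ys F = sym (∑-zero ys)
∑-swap (x ∷ xs) ys F =
  trans (cong (_+_ (∑ ys (F x))) (∑-swap xs ys F)) (sym (∑-+ (F x) _ ys))

count-∷ : ∀ (p : A → Bool) x xs → count p (x ∷ xs) ≡ ⟦ p x ⟧ + count p xs
count-∷ p x xs with p x
... | true = refl
... | false = refl

count≡∑ : ∀ (p : A → Bool) xs → count p xs ≡ ∑ xs (λ x → ⟦ p x ⟧)
count≡∑ p [] = refl
count≡∑ p (x ∷ xs) = trans (count-∷ p x xs) (cong (_+_ ⟦ p x ⟧) (count≡∑ p xs))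

count-cong : ∀ {p q : A → Bool} → (∀ x → p x ≡ q x) → ∀ xs → count p xs ≡ count q xs
count-cong {p = p} {q} p≗q xs =
  trans (count≡∑ p xs) (trans (∑-cong (cong ⟦_⟧ ∘ p≗q) xs) (sym (count≡∑ q xs)))

count-false : ∀ (xs : List A) → count (λ _ → false) xs ≡ 0
count-false [] = refl
count-false (_ ∷ xs) = count-false xs

count-∧ˡ : ∀ b (p : A → Bool) xs → count (λ x → b ∧ p x) xs ≡ ⟦ b ⟧ * count p xs
count-∧ˡ true p xs = sym (+-identityʳ _)
count-∧ˡ false p xs = count-false xs

count-∧-split : ∀ (p q : A → Bool) xs →
  count p xs ≡ count (λ x → p x ∧ q x) xs + count (λ x → p x ∧ not (q x)) xs
count-∧-split p q [] = refl
count-∧-split p q (x ∷ xs) with p x | q x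
... | true | true = cong suc (count-∧-split p q xs)
... | true | false = trans (cong suc (count-∧-split p q xs)) (sym (+-suc _ _))
... | false | _ = count-∧-split p q xs

count-map : ∀ (p : B → Bool) (f : A → B) xs → count p (map f xs) ≡ count (p ∘ f) xs
count-map p f [] = refl
count-map p f (x ∷ xs) with p (f x)
... | true = cong suc (count-map p f xs)
... | false = count-map p f xs

count-concatMap : ∀ (p : B → Bool) (f : A → List B) xs →
  count p (concatMap f xs) ≡ ∑ xs (λ x → count p (f x))
count-concatMap p f [] = refl
count-concatMap p f (x ∷ xs) = begin
  count p (f x ++ concatMap f xs)
    ≡⟨ cong length (filter-++ (T? ∘ p) (f x) _) ⟩
  length (filter (T? ∘ p) (f x) ++ filter (T? ∘ p) (concatMap f xs))
    ≡⟨ length-++ (filter (T? ∘ p) (f x)) ⟩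
  count p (f x) + count p (concatMap f xs)
    ≡⟨ cong (_+_ (count p (f x))) (count-concatMap p f xs) ⟩
  count p (f x) + ∑ xs (λ x → count p (f x)) ∎
  where open ≡-Reasoning

count-swap : ∀ (r : A → B → Bool) xs ys →
  ∑ xs (λ x → count (r x) ys) ≡ ∑ ys (λ y → count (λ x → r x y) xs)
count-swap r xs ys = begin
  ∑ xs (λ x → count (r x) ys)             ≡⟨ ∑-cong (λ x → count≡∑ (r x) ys) xs ⟩
  ∑ xs (λ x → ∑ ys (λ y → ⟦ r x y ⟧))     ≡⟨ ∑-swap xs ys _ ⟩
  ∑ ys (λ y → ∑ xs (λ x → ⟦ r x y ⟧))     ≡⟨ ∑-cong (λ y → count≡∑ _ xs) ys ⟨
  ∑ ys (λ y → count (λ x → r x y) xs)     ∎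
  where open ≡-Reasoning

count-fibres : ∀ (p : A → Bool) (r : B → A → Bool) xs ys →
  (∀ x → ⟦ p x ⟧ ≡ count (λ y → r y x) ys) → count p xs ≡ ∑ ys (λ y → count (r y) xs)
count-fibres p r xs ys fibre = begin
  count p xs                             ≡⟨ count≡∑ p xs ⟩
  ∑ xs (λ x → ⟦ p x ⟧)                   ≡⟨ ∑-cong fibre xs ⟩
  ∑ xs (λ x → count (λ y → r y x) ys)    ≡⟨ count-swap _ xs ys ⟩
  ∑ ys (λ y → count (r y) xs)            ∎
  where open ≡-Reasoning

count-∧-unique : ∀ b (r : A → Bool) xs → count r xs ≡ 1 → ⟦ b ⟧ ≡ count (λ x → b ∧ r x) xs
count-∧-unique b r xs unique =
  sym (trans (count-∧ˡ b r xs) (trans (cong (⟦ b ⟧ *_) unique) (*-identityʳ _)))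

-- Double counting of the graph { (x , y) | p x , y ≈ f x } = { (x , y) | q y , x ≈ g y },
-- where each list contains every element exactly once up to its equivalence.
count-bijection : ∀ (_≈ᴬ_ : A → A → Bool) (_≈ᴮ_ : B → B → Bool)
  (p : A → Bool) (q : B → Bool) (f : A → B) (g : B → A) xs ys →
  (∀ x → count (_≈ᴬ x) xs ≡ 1) → (∀ y → count (_≈ᴮ y) ys ≡ 1) →
  (∀ x y → (p x ∧ (y ≈ᴮ f x)) ≡ (q y ∧ (x ≈ᴬ g y))) →
  count p xs ≡ count q ys
count-bijection _≈ᴬ_ _≈ᴮ_ p q f g xs ys uniqueᴬ uniqueᴮ graph = begin
  count p xs
    ≡⟨ count-fibres p (λ y x → p x ∧ (y ≈ᴮ f x)) xs ys
         (λ x → count-∧-unique (p x) (_≈ᴮ f x) ys (uniqueᴮ (f x))) ⟩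
  ∑ ys (λ y → count (λ x → p x ∧ (y ≈ᴮ f x)) xs)
    ≡⟨ ∑-cong (λ y → count-cong (λ x → graph x y) xs) ys ⟩
  ∑ ys (λ y → count (λ x → q y ∧ (x ≈ᴬ g y)) xs)
    ≡⟨ ∑-cong (λ y → count-∧-unique (q y) (_≈ᴬ g y) xs (uniqueᴬ (g y))) ys ⟨
  ∑ ys (λ y → ⟦ q y ⟧)
    ≡⟨ count≡∑ q ys ⟨
  count q ys ∎
  where open ≡-Reasoning

∑-⟦⟧*-const : ∀ (c : A → Bool) (F : A → ℕ) {m} xs → (∀ x → T (c x) → F x ≡ m) →
  ∑ xs (λ x → ⟦ c x ⟧ * F x) ≡ count c xs * m
∑-⟦⟧*-const c F [] _ = refl
∑-⟦⟧*-const c F (x ∷ xs) F≡m with c x in cx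
... | true = cong₂ _+_ (trans (+-identityʳ (F x)) (F≡m x (subst T (sym cx) _)))
                       (∑-⟦⟧*-const c F xs F≡m)
... | false = ∑-⟦⟧*-const c F xs F≡m

allᶠ⁻ : ∀ (p : Fin n → Bool) → T (allᶠ p) → ∀ x → T (p x)
allᶠ⁻ {n} p t x = All.lookup (all⁺ p (allFin n) t) (∈-allFin x)

allᶠ⁺ : ∀ (p : Fin n → Bool) → (∀ x → T (p x)) → T (allᶠ p)
allᶠ⁺ {n} p all = all⁻ p {xs = allFin n} (All.tabulate (λ {x} _ → all x))

anyᶠ⁻ : ∀ (p : Fin n → Bool) → T (anyᶠ p) → ∃ λ x → T (p x)
anyᶠ⁻ {n} p t = satisfied (any⁻ p (allFin n) t)

anyᶠ⁺ : ∀ (p : Fin n → Bool) x → T (p x) → T (anyᶠ p)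
anyᶠ⁺ p x px = any⁺ p (lose (∈-allFin x) px)

allᶠ-cong : ∀ {p q : Fin n → Bool} → (∀ x → p x ≡ q x) → allᶠ p ≡ allᶠ q
allᶠ-cong p≗q = cong ListAction.and (map-cong p≗q (allFin _))

anyᶠ-cong : ∀ {p q : Fin n → Bool} → (∀ x → p x ≡ q x) → anyᶠ p ≡ anyᶠ q
anyᶠ-cong p≗q = cong ListAction.or (map-cong p≗q (allFin _))

countᶠ-cong : ∀ {p q : Fin n → Bool} → (∀ x → p x ≡ q x) → countᶠ p ≡ countᶠ q
countᶠ-cong p≗q = count-cong p≗q (allFin _)

allᶠ-suc : ∀ (p : Fin (suc n) → Bool) → allᶠ p ≡ p zero ∧ allᶠ (p ∘ suc)
allᶠ-suc p = cong (λ bs → p zero ∧ ListAction.and bs)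
  (trans (map-tabulate suc p) (sym (map-tabulate id (p ∘ suc))))

countᶠ-suc : ∀ (p : Fin (suc n) → Bool) → countᶠ p ≡ ⟦ p zero ⟧ + countᶠ (p ∘ suc)
countᶠ-suc p = trans (count-∷ p zero _) (cong (_+_ ⟦ p zero ⟧)
  (trans (cong (count p) (sym (map-tabulate id suc))) (count-map p suc (allFin _))))

countᶠ-punchIn : ∀ (p : Fin (suc n) → Bool) i → countᶠ p ≡ ⟦ p i ⟧ + countᶠ (p ∘ punchIn i)
countᶠ-punchIn p zero = countᶠ-suc p
countᶠ-punchIn {suc n} p (suc i) = begin
  countᶠ p
    ≡⟨ countᶠ-suc p ⟩
  ⟦ p zero ⟧ + countᶠ (p ∘ suc)
    ≡⟨ cong (_+_ ⟦ p zero ⟧) (countᶠ-punchIn (p ∘ suc) i) ⟩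
  ⟦ p zero ⟧ + (⟦ p (suc i) ⟧ + countᶠ (p ∘ suc ∘ punchIn i))
    ≡⟨ x∙yz≈y∙xz ⟦ p zero ⟧ ⟦ p (suc i) ⟧ _ ⟩
  ⟦ p (suc i) ⟧ + (⟦ p zero ⟧ + countᶠ (p ∘ suc ∘ punchIn i))
    ≡⟨ cong (_+_ ⟦ p (suc i) ⟧) (countᶠ-suc (p ∘ punchIn (suc i))) ⟨
  ⟦ p (suc i) ⟧ + countᶠ (p ∘ punchIn (suc i))
    ∎
  where open ≡-Reasoning

countᶠ-none : ∀ (p : Fin n → Bool) → (∀ x → ¬ T (p x)) → countᶠ p ≡ 0
countᶠ-none {n} p none =
  cong length (filter-none (T? ∘ p) {xs = allFin n} (All.tabulate (λ {x} _ → none x)))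

countᶠ-unique : ∀ (p : Fin (suc n) → Bool) y → T (p y) → (∀ x → T (p x) → x ≡ y) → countᶠ p ≡ 1
countᶠ-unique p y py unique = begin
  countᶠ p                          ≡⟨ countᶠ-punchIn p y ⟩
  ⟦ p y ⟧ + countᶠ (p ∘ punchIn y)  ≡⟨ cong₂ _+_ (⟦⟧≡1 (p y) py)
                                               (countᶠ-none _ λ x px → punchInᵢ≢i y x (unique _ px)) ⟩
  1                                 ∎
  where open ≡-Reasoning

countᶠ-<ᵇ : ∀ a → a ≤ n → countᶠ {n} (λ x → toℕ x ℕ.<ᵇ a) ≡ a
countᶠ-<ᵇ {n} zero _ = countᶠ-none {n} (λ x → toℕ x ℕ.<ᵇ 0) (λ _ ())
countᶠ-<ᵇ {suc n} (suc a) (s≤s a≤n) =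
  trans (countᶠ-suc {n} (λ x → toℕ x ℕ.<ᵇ suc a)) (cong suc (countᶠ-<ᵇ {n} a a≤n))

countᶠ-≤-∸ : ∀ (p : Fin n → Bool) l u → (∀ x → T (p x) → l ≤ toℕ x × toℕ x ℕ.< u) →
  countᶠ p ≤ u ∸ l
countᶠ-≤-∸ {zero} p l u _ = z≤n
countᶠ-≤-∸ {suc n} p zero zero within =
  ≤-reflexive (countᶠ-none p (λ x px → n≮0 (proj₂ (within x px))))
countᶠ-≤-∸ {suc n} p zero (suc u) within = begin
  countᶠ p                       ≡⟨ countᶠ-suc p ⟩
  ⟦ p zero ⟧ + countᶠ (p ∘ suc)  ≤⟨ +-mono-≤ (⟦⟧≤1 (p zero)) (countᶠ-≤-∸ (p ∘ suc) zero u
                                      λ x px → z≤n , ≤-pred (proj₂ (within (suc x) px))) ⟩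
  suc u                          ∎
  where
  open ≤-Reasoning
  ⟦⟧≤1 : ∀ b → ⟦ b ⟧ ≤ 1
  ⟦⟧≤1 true = ≤-refl
  ⟦⟧≤1 false = z≤n
countᶠ-≤-∸ {suc n} p (suc l) u within = begin
  countᶠ p                      ≡⟨ countᶠ-suc p ⟩
  ⟦ p zero ⟧ + countᶠ (p ∘ suc) ≡⟨ cong (λ c → c + countᶠ (p ∘ suc))
                                      (⟦⟧≡0 (p zero) λ p0 → n≮0 (proj₁ (within zero p0))) ⟩
  countᶠ (p ∘ suc)              ≤⟨ countᶠ-≤-∸ (p ∘ suc) l (u ∸ 1) (λ x px →
                                      let l≤x , x<u = within (suc x) px in ≤-pred l≤x , pred-< x<u) ⟩
  u ∸ 1 ∸ l                     ≡⟨ ∸-+-assoc u 1 l ⟩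
  u ∸ suc l                     ∎
  where
  open ≤-Reasoning
  pred-< : ∀ {a u} → suc a ℕ.< u → a ℕ.< u ∸ 1
  pred-< {u = suc u} (s≤s a<u) = a<u

-- Enumerating relations

Pointwise : (A → A → Bool) → (Fin m → A) → (Fin m → A) → Bool
Pointwise _≈_ f g = allᶠ (λ i → f i ≈ g i)

allFuns-unique : ∀ {A : Set} (_≈_ : A → A → Bool) xs → (∀ a → count (_≈ a) xs ≡ 1) →
  ∀ m (g : Fin m → A) → count (λ f → Pointwise _≈_ f g) (allFuns xs m) ≡ 1
allFuns-unique _≈_ xs unique zero g = refl
allFuns-unique {A} _≈_ xs unique (suc m) g = begin
  count (λ f → Pointwise _≈_ f g) (allFuns xs (suc m))
    ≡⟨ count-concatMap (λ f → Pointwise _≈_ f g) _ xs ⟩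
  ∑ xs (λ a → count (λ f → Pointwise _≈_ f g) (map _ (allFuns xs m)))
    ≡⟨ ∑-cong (λ a → trans (count-map (λ f → Pointwise _≈_ f g) _ (allFuns xs m))
                           (extension-unique a _ (λ _ → refl) (λ _ _ → refl))) xs ⟩
  ∑ xs (λ a → ⟦ a ≈ g zero ⟧)
    ≡⟨ count≡∑ (_≈ g zero) xs ⟨
  count (_≈ g zero) xs
    ≡⟨ unique (g zero) ⟩
  1 ∎
  where
  open ≡-Reasoning
  extension-unique : ∀ a (ext : (Fin m → A) → Fin (suc m) → A) →
    (∀ f → ext f zero ≡ a) → (∀ f i → ext f (suc i) ≡ f i) →
    count (λ f → Pointwise _≈_ (ext f) g) (allFuns xs m) ≡ ⟦ a ≈ g zero ⟧
  extension-unique a ext ext-zero ext-suc = begin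
    count (λ f → Pointwise _≈_ (ext f) g) (allFuns xs m)
      ≡⟨ count-cong (λ f → trans (allᶠ-suc (λ i → ext f i ≈ g i))
           (cong₂ _∧_ (cong (_≈ g zero) (ext-zero f))
                      (allᶠ-cong (λ i → cong (_≈ g (suc i)) (ext-suc f i))))) (allFuns xs m) ⟩
    count (λ f → (a ≈ g zero) ∧ Pointwise _≈_ f (g ∘ suc)) (allFuns xs m)
      ≡⟨ count-∧-unique (a ≈ g zero) (λ f → Pointwise _≈_ f (g ∘ suc)) (allFuns xs m)
           (allFuns-unique _≈_ xs unique m (g ∘ suc)) ⟨
    ⟦ a ≈ g zero ⟧ ∎

_≈_ : Rel₂ n → Rel₂ n → Set
R ≈ S = ∀ x y → R x y ≡ S x y

_≡ᵇ_ : Bool → Bool → Bool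
a ≡ᵇ b = ⌊ a Bool.≟ b ⌋

_≐_ : Rel₂ n → Rel₂ n → Bool
_≐_ = Pointwise (Pointwise _≡ᵇ_)

≐⇒≈ : ∀ (R S : Rel₂ n) → T (R ≐ S) → R ≈ S
≐⇒≈ R S t x y =
  toWitness (allᶠ⁻ (λ y → R x y ≡ᵇ S x y) (allᶠ⁻ (λ x → Pointwise _≡ᵇ_ (R x) (S x)) t x) y)

≈⇒≐ : ∀ (R S : Rel₂ n) → R ≈ S → T (R ≐ S)
≈⇒≐ R S R≈S = allᶠ⁺ (λ x → Pointwise _≡ᵇ_ (R x) (S x)) (λ x →
  allᶠ⁺ (λ y → R x y ≡ᵇ S x y) (λ y → fromWitness (R≈S x y)))

allRels-unique : ∀ (S : Rel₂ n) → count (_≐ S) (allRels n) ≡ 1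
allRels-unique {n} = allFuns-unique _ _ (allFuns-unique _≡ᵇ_ _ Bool-unique n) n
  where
  Bool-unique : ∀ b → count (_≡ᵇ b) (true ∷ false ∷ []) ≡ 1
  Bool-unique true = refl
  Bool-unique false = refl

<ᶠ⇒< : ∀ {x y : Fin n} → T (x <ᶠ y) → x < y
<ᶠ⇒< {x = x} {y} = <ᵇ⇒< (toℕ x) (toℕ y)

<⇒<ᶠ : ∀ {x y : Fin n} → x < y → T (x <ᶠ y)
<⇒<ᶠ = <⇒<ᵇ

SameBlock : Rel₂ n → Fin n → Fin n → Set
SameBlock R x y = T (R x y)

Head : Rel₂ n → Fin n → Set
Head R x = ∀ {y} → y < x → ¬ SameBlock R y x

record FrontEdge (R : Rel₂ n) (x y : Fin n) : Set where
  field
    ordered : x < y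
    sameBlock : SameBlock R x y
    headed : Head R x

frontCrossingAt : ℕ → Rel₂ n → Fin n → Fin n → Fin n → Fin n → Bool
frontCrossingAt k R i₁ j₁ i₂ j₂ =
  frontEdge R i₁ j₁ ∧ frontEdge R i₂ j₂ ∧ (i₁ <ᶠ i₂) ∧ (i₂ <ᶠ j₁) ∧ (j₁ <ᶠ j₂) ∧
  ((k ∸ 2) ℕ.≤ᵇ headsBetween R i₂ j₁)

record FrontCrossingAt (k : ℕ) (R : Rel₂ n) (i₁ j₁ i₂ j₂ : Fin n) : Set where
  field
    edge₁ : FrontEdge R i₁ j₁
    edge₂ : FrontEdge R i₂ j₂
    i₁<i₂ : i₁ < i₂
    i₂<j₁ : i₂ < j₁
    j₁<j₂ : j₁ < j₂
    enoughHeads : k ∸ 2 ≤ headsBetween R i₂ j₁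

admissible : ℕ → ℕ → Rel₂ n → Bool
admissible k a R = isEquivalence R ∧ not (hasFrontCrossing k R) ∧ firstAreHeads a R

record Admissible (k a : ℕ) (R : Rel₂ n) : Set where
  field
    equivalence : IsEquivalence (SameBlock R)
    noncrossing : ∀ i₁ j₁ i₂ j₂ → ¬ T (frontCrossingAt k R i₁ j₁ i₂ j₂)
    firstHeads : ∀ x → toℕ x ℕ.< a → Head R x

module _ (R : Rel₂ n) where

  isHead⇒Head : ∀ x → T (isHead R x) → Head R x
  isHead⇒Head x head {y} y<x yRx =
    T-not⁻ (anyᶠ (λ y → (y <ᶠ x) ∧ R y x)) head
      (anyᶠ⁺ (λ y → (y <ᶠ x) ∧ R y x) y (T-∧⁺ (y <ᶠ x) (<⇒<ᶠ y<x) yRx))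

  Head⇒isHead : ∀ x → Head R x → T (isHead R x)
  Head⇒isHead x head = T-not⁺ (anyᶠ (λ y → (y <ᶠ x) ∧ R y x)) λ t →
    let y , below = anyᶠ⁻ (λ y → (y <ᶠ x) ∧ R y x) t
        y<x , yRx = T-∧⁻ (y <ᶠ x) below
    in head (<ᶠ⇒< y<x) yRx

  ¬Head⇒sameBlockBelow : ∀ x → ¬ Head R x → ∃ λ y → y < x × SameBlock R y x
  ¬Head⇒sameBlockBelow x ¬head with T? (anyᶠ (λ y → (y <ᶠ x) ∧ R y x))
  ... | yes t = let y , below = anyᶠ⁻ (λ y → (y <ᶠ x) ∧ R y x) t
                    y<x , yRx = T-∧⁻ (y <ᶠ x) below
                in y , <ᶠ⇒< y<x , yRx
  ... | no ¬t = ⊥-elim (¬head (isHead⇒Head x (T-not⁺ _ ¬t)))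

  frontEdge⇒ : ∀ {x y} → T (frontEdge R x y) → FrontEdge R x y
  frontEdge⇒ {x} {y} t =
    let x<y , rest = T-∧⁻ (x <ᶠ y) t
        xRy , head = T-∧⁻ (R x y) rest
    in record { ordered = <ᶠ⇒< x<y ; sameBlock = xRy ; headed = isHead⇒Head x head }

  frontCrossingAt⇒ : ∀ k i₁ j₁ i₂ j₂ → T (frontCrossingAt k R i₁ j₁ i₂ j₂) →
    FrontCrossingAt k R i₁ j₁ i₂ j₂
  frontCrossingAt⇒ k i₁ j₁ i₂ j₂ t =
    let e₁ , t₁ = T-∧⁻ (frontEdge R i₁ j₁) t
        e₂ , t₂ = T-∧⁻ (frontEdge R i₂ j₂) t₁
        o₁ , t₃ = T-∧⁻ (i₁ <ᶠ i₂) t₂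
        o₂ , t₄ = T-∧⁻ (i₂ <ᶠ j₁) t₃
        o₃ , hb = T-∧⁻ (j₁ <ᶠ j₂) t₄
    in record
      { edge₁ = frontEdge⇒ e₁ ; edge₂ = frontEdge⇒ e₂
      ; i₁<i₂ = <ᶠ⇒< o₁ ; i₂<j₁ = <ᶠ⇒< o₂ ; j₁<j₂ = <ᶠ⇒< o₃
      ; enoughHeads = ≤ᵇ⇒≤ (k ∸ 2) _ hb }

  private
    reflexive symmetric transitive : Fin n → Bool
    reflexive x = R x x
    symmetric x = allᶠ (λ y → not (R x y) ∨ R y x)
    transitive x = allᶠ (λ y → allᶠ (λ z → not (R x y ∧ R y z) ∨ R x z))

    crossingFrom : ℕ → Fin n → Bool
    crossingFrom k i₁ = anyᶠ (λ j₁ → anyᶠ (λ i₂ → anyᶠ (frontCrossingAt k R i₁ j₁ i₂)))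

  isEquivalence⇒ : T (isEquivalence R) → IsEquivalence (SameBlock R)
  isEquivalence⇒ t =
    let r , st = T-∧⁻ (allᶠ reflexive) t
        s , tr = T-∧⁻ (allᶠ symmetric) st
    in record
      { refl = λ {x} → allᶠ⁻ reflexive r x
      ; sym = λ {x} {y} → T-⇒⁻ (R x y) (allᶠ⁻ _ (allᶠ⁻ symmetric s x) y)
      ; trans = λ {x} {y} {z} xRy yRz →
          T-⇒⁻ (R x y ∧ R y z) (allᶠ⁻ _ (allᶠ⁻ _ (allᶠ⁻ transitive tr x) y) z)
            (T-∧⁺ (R x y) xRy yRz)
      }

  isEquivalence⇐ : IsEquivalence (SameBlock R) → T (isEquivalence R)
  isEquivalence⇐ eqv =
    T-∧⁺ (allᶠ reflexive) (allᶠ⁺ reflexive (λ _ → E.refl))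
   (T-∧⁺ (allᶠ symmetric) (allᶠ⁺ symmetric λ x → allᶠ⁺ _ λ y → T-⇒⁺ (R x y) E.sym)
         (allᶠ⁺ transitive λ x → allᶠ⁺ _ λ y → allᶠ⁺ _ λ z → T-⇒⁺ (R x y ∧ R y z) λ xRyRz →
            let xRy , yRz = T-∧⁻ (R x y) xRyRz in E.trans xRy yRz))
    where module E = IsEquivalence eqv

  noFrontCrossing⇒ : ∀ {k} → T (not (hasFrontCrossing k R)) →
    ∀ i₁ j₁ i₂ j₂ → ¬ T (frontCrossingAt k R i₁ j₁ i₂ j₂)
  noFrontCrossing⇒ {k} none i₁ j₁ i₂ j₂ crossing =
    T-not⁻ (hasFrontCrossing k R) none
      (anyᶠ⁺ (crossingFrom k) i₁ (anyᶠ⁺ _ j₁ (anyᶠ⁺ _ i₂ (anyᶠ⁺ _ j₂ crossing))))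

  noFrontCrossing⇐ : ∀ {k} → (∀ i₁ j₁ i₂ j₂ → ¬ T (frontCrossingAt k R i₁ j₁ i₂ j₂)) →
    T (not (hasFrontCrossing k R))
  noFrontCrossing⇐ {k} none = T-not⁺ (hasFrontCrossing k R) λ t →
    let i₁ , t₁ = anyᶠ⁻ (crossingFrom k) t
        j₁ , t₂ = anyᶠ⁻ (λ j₁ → anyᶠ (λ i₂ → anyᶠ (frontCrossingAt k R i₁ j₁ i₂))) t₁
        i₂ , t₃ = anyᶠ⁻ (λ i₂ → anyᶠ (frontCrossingAt k R i₁ j₁ i₂)) t₂
        j₂ , t₄ = anyᶠ⁻ (frontCrossingAt k R i₁ j₁ i₂) t₃
    in none i₁ j₁ i₂ j₂ t₄

  firstAreHeads⇒ : ∀ a → T (firstAreHeads a R) → ∀ x → toℕ x ℕ.< a → Head R x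
  firstAreHeads⇒ a t x x<a = isHead⇒Head x
    (T-⇒⁻ (toℕ x ℕ.<ᵇ a) (allᶠ⁻ (λ x → not (toℕ x ℕ.<ᵇ a) ∨ isHead R x) t x) (<⇒<ᵇ x<a))

  firstAreHeads⇐ : ∀ a → (∀ x → toℕ x ℕ.< a → Head R x) → T (firstAreHeads a R)
  firstAreHeads⇐ a heads = allᶠ⁺ (λ x → not (toℕ x ℕ.<ᵇ a) ∨ isHead R x) λ x →
    T-⇒⁺ (toℕ x ℕ.<ᵇ a) λ x<a → Head⇒isHead x (heads x (<ᵇ⇒< (toℕ x) a x<a))

  admissible⇒ : ∀ k a → T (admissible k a R) → Admissible k a R
  admissible⇒ k a t =
    let eq , t₁ = T-∧⁻ (isEquivalence R) t
        nc , fh = T-∧⁻ (not (hasFrontCrossing k R)) t₁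
    in record
      { equivalence = isEquivalence⇒ eq
      ; noncrossing = noFrontCrossing⇒ {k} nc
      ; firstHeads = firstAreHeads⇒ a fh }

  admissible⇐ : ∀ k a → Admissible k a R → T (admissible k a R)
  admissible⇐ k a adm =
    T-∧⁺ (isEquivalence R) (isEquivalence⇐ equivalence)
      (T-∧⁺ (not (hasFrontCrossing k R)) (noFrontCrossing⇐ {k} noncrossing)
            (firstAreHeads⇐ a firstHeads))
    where open Admissible adm

heads-sameBlock⇒≡ : ∀ {R : Rel₂ n} {x y} → IsEquivalence (SameBlock R) →
  Head R x → Head R y → SameBlock R x y → x ≡ y
heads-sameBlock⇒≡ {x = x} {y} eqv head-x head-y xRy with <-cmp x y
... | tri< x<y _ _ = ⊥-elim (head-y x<y xRy)
... | tri≈ _ x≡y _ = x≡y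
... | tri> _ _ y<x = ⊥-elim (head-x y<x (IsEquivalence.sym eqv xRy))

headsBetween-≤ : ∀ (R : Rel₂ n) x y → headsBetween R x y ≤ toℕ y ∸ suc (toℕ x)
headsBetween-≤ R x y = countᶠ-≤-∸ _ (suc (toℕ x)) (toℕ y) λ h between →
  let x<h , rest = T-∧⁻ (x <ᶠ h) between
  in <ᶠ⇒< x<h , <ᶠ⇒< (proj₁ (T-∧⁻ (h <ᶠ y) rest))

module _ {R S : Rel₂ n} (R≈S : R ≈ S) where

  isHead-cong : ∀ x → isHead R x ≡ isHead S x
  isHead-cong x = cong not (anyᶠ-cong (λ y → cong ((y <ᶠ x) ∧_) (R≈S y x)))

  frontEdge-cong : ∀ x y → frontEdge R x y ≡ frontEdge S x y
  frontEdge-cong x y = cong ((x <ᶠ y) ∧_) (cong₂ _∧_ (R≈S x y) (isHead-cong x))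

  headsBetween-cong : ∀ x y → headsBetween R x y ≡ headsBetween S x y
  headsBetween-cong x y =
    countᶠ-cong (λ h → cong (λ b → (x <ᶠ h) ∧ (h <ᶠ y) ∧ b) (isHead-cong h))

  hasFrontCrossing-cong : ∀ k → hasFrontCrossing k R ≡ hasFrontCrossing k S
  hasFrontCrossing-cong k =
    anyᶠ-cong λ i₁ → anyᶠ-cong λ j₁ → anyᶠ-cong λ i₂ → anyᶠ-cong λ j₂ →
      cong₂ _∧_ (frontEdge-cong i₁ j₁) (cong₂ _∧_ (frontEdge-cong i₂ j₂)
        (cong (λ c → (i₁ <ᶠ i₂) ∧ (i₂ <ᶠ j₁) ∧ (j₁ <ᶠ j₂) ∧ ((k ∸ 2) ℕ.≤ᵇ c))
              (headsBetween-cong i₂ j₁)))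

  isEquivalence-cong : isEquivalence R ≡ isEquivalence S
  isEquivalence-cong = cong₂ _∧_ (allᶠ-cong λ x → R≈S x x) (cong₂ _∧_
    (allᶠ-cong λ x → allᶠ-cong λ y → cong₂ (λ b c → not b ∨ c) (R≈S x y) (R≈S y x))
    (allᶠ-cong λ x → allᶠ-cong λ y → allᶠ-cong λ z →
      cong₂ (λ b c → not b ∨ c) (cong₂ _∧_ (R≈S x y) (R≈S y z)) (R≈S x z)))

  admissible-cong : ∀ k a → admissible k a R ≡ admissible k a S
  admissible-cong k a = cong₂ _∧_ isEquivalence-cong (cong₂ _∧_
    (cong not (hasFrontCrossing-cong k))
    (allᶠ-cong λ x → cong (not (toℕ x ℕ.<ᵇ a) ∨_) (isHead-cong x)))

-- Deleting an element that is not a head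

punchIn-mono-< : ∀ i {x y : Fin n} → x < y → punchIn i x < punchIn i y
punchIn-mono-< zero x<y = s≤s x<y
punchIn-mono-< (suc i) {zero} {suc y} _ = s≤s z≤n
punchIn-mono-< (suc i) {suc x} {suc y} (s≤s x<y) = s≤s (punchIn-mono-< i x<y)

punchIn-cancel-< : ∀ i {x y : Fin n} → punchIn i x < punchIn i y → x < y
punchIn-cancel-< zero (s≤s x<y) = x<y
punchIn-cancel-< (suc i) {zero} {suc y} _ = s≤s z≤n
punchIn-cancel-< (suc i) {suc x} {suc y} (s≤s x<y) = s≤s (punchIn-cancel-< i x<y)

toℕ≤toℕ-punchIn : ∀ i (x : Fin n) → toℕ x ≤ toℕ (punchIn i x)
toℕ≤toℕ-punchIn zero x = n≤1+n _
toℕ≤toℕ-punchIn (suc i) zero = z≤n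
toℕ≤toℕ-punchIn (suc i) (suc x) = s≤s (toℕ≤toℕ-punchIn i x)

toℕ-punchIn-< : ∀ i (x : Fin n) → toℕ x ℕ.< toℕ i → toℕ (punchIn i x) ≡ toℕ x
toℕ-punchIn-< (suc i) zero _ = refl
toℕ-punchIn-< (suc i) (suc x) (s≤s x<i) = cong suc (toℕ-punchIn-< i x x<i)

<ᶠ-punchIn : ∀ i (x y : Fin n) → (punchIn i x <ᶠ punchIn i y) ≡ (x <ᶠ y)
<ᶠ-punchIn i x y = T-ext (<⇒<ᶠ ∘ punchIn-cancel-< i ∘ <ᶠ⇒<) (<⇒<ᶠ ∘ punchIn-mono-< i ∘ <ᶠ⇒<)

data PunchInView (i : Fin (suc n)) : Fin (suc n) → Set where
  at : PunchInView i i
  punched : ∀ x → PunchInView i (punchIn i x)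

punchInView : ∀ (i x : Fin (suc n)) → PunchInView i x
punchInView i x with i Fin.≟ x
... | yes refl = at
... | no i≢x = subst (PunchInView i) (punchIn-punchOut i≢x) (punched (punchOut i≢x))

record Deletion (p : Fin (suc n)) (R : Rel₂ (suc n)) (R' : Rel₂ n) : Set where
  field
    ¬head : ¬ Head R p
    sameBlock-punchIn : ∀ x y → R (punchIn p x) (punchIn p y) ≡ R' x y
    isHead-punchIn : ∀ x → isHead R (punchIn p x) ≡ isHead R' x

module _ {p : Fin (suc n)} {R R'} (D : Deletion p R R') where
  open Deletion D

  Head-punchIn⁺ : ∀ {x} → Head R' x → Head R (punchIn p x)
  Head-punchIn⁺ {x} head =
    isHead⇒Head R _ (subst T (sym (isHead-punchIn x)) (Head⇒isHead R' x head))

  Head-punchIn⁻ : ∀ {x} → Head R (punchIn p x) → Head R' x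
  Head-punchIn⁻ {x} head =
    isHead⇒Head R' x (subst T (isHead-punchIn x) (Head⇒isHead R _ head))

  frontEdge-punchIn : ∀ x y → frontEdge R (punchIn p x) (punchIn p y) ≡ frontEdge R' x y
  frontEdge-punchIn x y =
    cong₂ _∧_ (<ᶠ-punchIn p x y) (cong₂ _∧_ (sameBlock-punchIn x y) (isHead-punchIn x))

  -- p itself is not counted, being no head.
  headsBetween-punchIn : ∀ x y →
    headsBetween R (punchIn p x) (punchIn p y) ≡ headsBetween R' x y
  headsBetween-punchIn x y = begin
    countᶠ q                            ≡⟨ countᶠ-punchIn q p ⟩
    ⟦ q p ⟧ + countᶠ (q ∘ punchIn p)    ≡⟨ cong₂ _+_ (⟦⟧≡0 (q p) p∉q) (countᶠ-cong λ h →
                                             cong₂ _∧_ (<ᶠ-punchIn p x h)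
                                               (cong₂ _∧_ (<ᶠ-punchIn p h y) (isHead-punchIn h))) ⟩
    headsBetween R' x y                 ∎
    where
    open ≡-Reasoning
    q : Fin (suc _) → Bool
    q h = (punchIn p x <ᶠ h) ∧ (h <ᶠ punchIn p y) ∧ isHead R h
    p∉q : ¬ T (q p)
    p∉q t = ¬head (isHead⇒Head R p
      (proj₂ (T-∧⁻ (p <ᶠ punchIn p y) (proj₂ (T-∧⁻ (punchIn p x <ᶠ p) t)))))

  frontCrossingAt-punchIn : ∀ k i₁ j₁ i₂ j₂ →
    frontCrossingAt k R (punchIn p i₁) (punchIn p j₁) (punchIn p i₂) (punchIn p j₂) ≡
    frontCrossingAt k R' i₁ j₁ i₂ j₂
  frontCrossingAt-punchIn k i₁ j₁ i₂ j₂ =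
    cong₂ _∧_ (frontEdge-punchIn i₁ j₁) (cong₂ _∧_ (frontEdge-punchIn i₂ j₂)
      (cong₂ _∧_ (<ᶠ-punchIn p i₁ i₂) (cong₂ _∧_ (<ᶠ-punchIn p i₂ j₁)
        (cong₂ _∧_ (<ᶠ-punchIn p j₁ j₂) (cong ((k ∸ 2) ℕ.≤ᵇ_) (headsBetween-punchIn i₂ j₁))))))

-- Merging p into the block of j < p

fewer-heads-than-needed : ∀ {k a b} → 0 ℕ.< b → b ℕ.< a → a ℕ.< k → ¬ (k ∸ 2 ≤ a ∸ suc b)
fewer-heads-than-needed {a = suc (suc a)} {suc b} (s≤s z≤n) (s≤s (s≤s _)) (s≤s (s≤s a<k)) enough =
  <⇒≱ a<k (≤-trans enough (m∸n≤m a b))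

module Merging {n} (p j : Fin (suc n)) (j<p : j < p) where
  open FrontEdge
  open FrontCrossingAt

  p≢j : p ≢ j
  p≢j p≡j = Fin.<⇒≢ j<p (sym p≡j)

  -- Renumbers [n + 1] ∖ {p} as [n], sending p to the image of j.
  squash : Fin (suc n) → Fin n
  squash y with p Fin.≟ y
  ... | yes _ = punchOut p≢j
  ... | no p≢y = punchOut p≢y

  squash-punchIn : ∀ x → squash (punchIn p x) ≡ x
  squash-punchIn x with p Fin.≟ punchIn p x
  ... | yes p≡ = ⊥-elim (punchInᵢ≢i p x (sym p≡))
  ... | no _ = trans (Fin.punchOut-cong p refl) (Fin.punchOut-punchIn p)

  punchIn-squash : ∀ y → p ≢ y → punchIn p (squash y) ≡ y
  punchIn-squash y p≢y with p Fin.≟ y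
  ... | yes p≡y = ⊥-elim (p≢y p≡y)
  ... | no p≢y′ = punchIn-punchOut p≢y′

  punchIn-squash-p : punchIn p (squash p) ≡ j
  punchIn-squash-p with p Fin.≟ p
  ... | yes _ = punchIn-punchOut p≢j
  ... | no p≢p = ⊥-elim (p≢p refl)

  squash-j : squash j ≡ squash p
  squash-j = Fin.punchIn-injective p _ _ (trans (punchIn-squash j p≢j) (sym punchIn-squash-p))

  punchIn-squash-≤ : ∀ y → toℕ (punchIn p (squash y)) ≤ toℕ y
  punchIn-squash-≤ y with p Fin.≟ y
  ... | yes refl = subst (λ z → toℕ z ≤ toℕ p) (sym (punchIn-punchOut p≢j)) (<⇒≤ j<p)
  ... | no p≢y = ≤-reflexive (cong toℕ (punchIn-punchOut p≢y))

  delete : Rel₂ (suc n) → Rel₂ n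
  delete R x y = R (punchIn p x) (punchIn p y)

  merge : Rel₂ n → Rel₂ (suc n)
  merge S x y = S (squash x) (squash y)

  delete-merge : ∀ S → delete (merge S) ≈ S
  delete-merge S x y = cong₂ S (squash-punchIn x) (squash-punchIn y)

  module _ {R : Rel₂ (suc n)} (eqv : IsEquivalence (SameBlock R)) (jRp : SameBlock R j p) where
    open IsEquivalence eqv using () renaming (refl to ∼-refl; sym to ∼-sym; trans to ∼-trans)

    sameBlock-squash : ∀ y → SameBlock R (punchIn p (squash y)) y
    sameBlock-squash y with p Fin.≟ y
    ... | yes refl = subst (λ z → SameBlock R z p) (sym (punchIn-punchOut p≢j)) jRp
    ... | no p≢y = subst (λ z → SameBlock R z y) (sym (punchIn-punchOut p≢y)) ∼-refl

    merge-delete : merge (delete R) ≈ R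
    merge-delete x y = T-ext
      (λ r → ∼-trans (∼-sym (sameBlock-squash x)) (∼-trans r (sameBlock-squash y)))
      (λ r → ∼-trans (sameBlock-squash x) (∼-trans r (∼-sym (sameBlock-squash y))))

    -- A block-mate y < punchIn p x yields the block-mate punchIn p (squash y) ≤ y.
    deletion : Deletion p R (delete R)
    deletion = record
      { ¬head = λ head → head j<p jRp
      ; sameBlock-punchIn = λ _ _ → refl
      ; isHead-punchIn = λ x → T-ext
          (λ t → Head⇒isHead (delete R) x λ y<x → isHead⇒Head R _ t (punchIn-mono-< p y<x))
          (λ t → Head⇒isHead R _ λ {y} y<x yRx → isHead⇒Head (delete R) x t
             (punchIn-cancel-< p (≤-<-trans (punchIn-squash-≤ y) y<x))
             (∼-trans (sameBlock-squash y) yRx))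
      }

  merge-sameBlock : ∀ S → IsEquivalence (SameBlock S) → SameBlock (merge S) j p
  merge-sameBlock S eqv =
    subst (λ z → SameBlock S z (squash p)) (sym squash-j) (IsEquivalence.refl eqv)

  merge-deletion : ∀ S → IsEquivalence (SameBlock S) → Deletion p (merge S) S
  merge-deletion S eqv = record
    { ¬head = λ head → head j<p (merge-sameBlock S eqv)
    ; sameBlock-punchIn = delete-merge S
    ; isHead-punchIn = λ x → T-ext
        (λ t → Head⇒isHead S x λ {y} y<x ySx → isHead⇒Head (merge S) _ t
           (punchIn-mono-< p y<x) (subst T (sym (delete-merge S y x)) ySx))
        (λ t → Head⇒isHead (merge S) _ λ {y} y<x ySx → isHead⇒Head S x t
           (punchIn-cancel-< p (≤-<-trans (punchIn-squash-≤ y) y<x))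
           (subst (λ z → SameBlock S (squash y) z) (squash-punchIn x) ySx))
    }

  delete-admissible : ∀ {k R} → SameBlock R j p →
    Admissible k (toℕ p) R → Admissible k (toℕ p) (delete R)
  delete-admissible {k} {R} jRp adm = record
    { equivalence = On.isEquivalence (punchIn p) equivalence
    ; noncrossing = λ i₁ j₁ i₂ j₂ c →
        noncrossing (punchIn p i₁) (punchIn p j₁) (punchIn p i₂) (punchIn p j₂)
          (subst T (sym (frontCrossingAt-punchIn D k i₁ j₁ i₂ j₂)) c)
    ; firstHeads = λ x x<p → Head-punchIn⁻ D
        (firstHeads _ (subst (ℕ._< toℕ p) (sym (toℕ-punchIn-< p x x<p)) x<p))
    }
    where
    open Admissible adm
    D = deletion equivalence jRp

  -- A crossing of merge S avoiding p is one of S.  It cannot start at p, which is no head;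
  -- it cannot end its second edge at p, since j₁ < p is a head; and it cannot end its
  -- first edge at p, as fewer than k - 2 heads lie strictly between i₂ ≥ 1 and p < k.
  merge-admissible : ∀ {k S} → toℕ p ℕ.< k →
    Admissible k (toℕ p) S → Admissible k (toℕ p) (merge S)
  merge-admissible {k} {S} p<k adm = record
    { equivalence = On.isEquivalence squash equivalence
    ; noncrossing = merge-noncrossing
    ; firstHeads = merge-firstHeads
    }
    where
    open Admissible adm
    D = merge-deletion S equivalence
    open Deletion D using (¬head)

    merge-firstHeads : ∀ x → toℕ x ℕ.< toℕ p → Head (merge S) x
    merge-firstHeads x x<p with punchInView p x
    ... | at = ⊥-elim (<-irrefl refl x<p)
    ... | punched x′ = Head-punchIn⁺ D (firstHeads x′ (≤-<-trans (toℕ≤toℕ-punchIn p x′) x<p))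

    merge-noncrossing : ∀ i₁ j₁ i₂ j₂ → ¬ T (frontCrossingAt k (merge S) i₁ j₁ i₂ j₂)
    merge-noncrossing i₁ j₁ i₂ j₂ c
      with frontCrossingAt⇒ (merge S) k i₁ j₁ i₂ j₂ c
         | punchInView p i₁ | punchInView p j₁ | punchInView p i₂ | punchInView p j₂
    ... | cr | at | _ | _ | _ = ¬head (headed (edge₁ cr))
    ... | cr | _ | _ | at | _ = ¬head (headed (edge₂ cr))
    ... | cr | _ | _ | _ | at =
      merge-firstHeads _ (j₁<j₂ cr) (ordered (edge₁ cr)) (sameBlock (edge₁ cr))
    ... | cr | _ | at | _ | _ =
      fewer-heads-than-needed (≤-<-trans z≤n (i₁<i₂ cr)) (i₂<j₁ cr) p<k
        (≤-trans (enoughHeads cr) (headsBetween-≤ (merge S) _ p))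
    ... | _ | punched i₁ | punched j₁ | punched i₂ | punched j₂ =
      noncrossing i₁ j₁ i₂ j₂ (subst T (frontCrossingAt-punchIn D k i₁ j₁ i₂ j₂) c)

  count-sameBlock : ∀ k → toℕ p ℕ.< k →
    count (λ R → admissible k (toℕ p) R ∧ R j p) (allRels (suc n)) ≡ h k (toℕ p) n
  count-sameBlock k p<k = count-bijection _≐_ _≐_ (λ R → admissible k a R ∧ R j p) (admissible k a)
    delete merge (allRels (suc n)) (allRels n) allRels-unique allRels-unique
    (λ R S → T-ext (deleted R S) (merged R S))
    where
    a = toℕ p

    deleted : ∀ R S → T ((admissible k a R ∧ R j p) ∧ (S ≐ delete R)) →
      T (admissible k a S ∧ (R ≐ merge S))
    deleted R S t =
      let adm-jRp , S≐ = T-∧⁻ (admissible k a R ∧ R j p) t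
          admR , jRp = T-∧⁻ (admissible k a R) adm-jRp
          S≈ = ≐⇒≈ S (delete R) S≐
          adm = admissible⇒ R k a admR
      in T-∧⁺ (admissible k a S)
           (subst T (sym (admissible-cong S≈ k a))
              (admissible⇐ (delete R) k a (delete-admissible jRp adm)))
           (≈⇒≐ R (merge S) λ x y →
              trans (sym (merge-delete (Admissible.equivalence adm) jRp x y))
                    (sym (S≈ (squash x) (squash y))))

    merged : ∀ R S → T (admissible k a S ∧ (R ≐ merge S)) →
      T ((admissible k a R ∧ R j p) ∧ (S ≐ delete R))
    merged R S t =
      let admS , R≐ = T-∧⁻ (admissible k a S) t
          R≈ = ≐⇒≈ R (merge S) R≐
          adm = admissible⇒ S k a admS
      in T-∧⁺ (admissible k a R ∧ R j p)
           (T-∧⁺ (admissible k a R)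
              (subst T (sym (admissible-cong R≈ k a))
                 (admissible⇐ (merge S) k a (merge-admissible p<k adm)))
              (subst T (sym (R≈ j p))
                 (merge-sameBlock S (Admissible.equivalence adm))))
           (≈⇒≐ S (delete R) λ x y → trans (sym (delete-merge S x y)) (sym (R≈ _ _)))

-- The recurrence

firstAreHeads-suc : ∀ (R : Rel₂ n) p →
  firstAreHeads (suc (toℕ p)) R ≡ firstAreHeads (toℕ p) R ∧ isHead R p
firstAreHeads-suc R p = T-ext
  (λ t → T-∧⁺ (firstAreHeads (toℕ p) R)
     (firstAreHeads⇐ R (toℕ p) λ x x<p → firstAreHeads⇒ R (suc (toℕ p)) t x (m<n⇒m<1+n x<p))
     (Head⇒isHead R p (firstAreHeads⇒ R (suc (toℕ p)) t p (n<1+n (toℕ p)))))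
  (λ t → let heads , head-p = T-∧⁻ (firstAreHeads (toℕ p) R) t
         in firstAreHeads⇐ R (suc (toℕ p)) λ x x≤p → case-≤ x heads head-p (≤-pred x≤p))
  where
  case-≤ : ∀ x → T (firstAreHeads (toℕ p) R) → T (isHead R p) → toℕ x ≤ toℕ p → Head R x
  case-≤ x heads head-p x≤p with m≤n⇒m<n∨m≡n x≤p
  ... | inj₁ x<p = firstAreHeads⇒ R (toℕ p) heads x x<p
  ... | inj₂ x≡p = isHead⇒Head R x (subst (T ∘ isHead R) (sym (toℕ-injective x≡p)) head-p)

admissible-suc : ∀ k (R : Rel₂ n) p →
  admissible k (suc (toℕ p)) R ≡ admissible k (toℕ p) R ∧ isHead R p
admissible-suc k R p = begin
  E ∧ N ∧ firstAreHeads (suc (toℕ p)) R  ≡⟨ cong (λ b → E ∧ N ∧ b) (firstAreHeads-suc R p) ⟩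
  E ∧ N ∧ (F ∧ isHead R p)                ≡⟨ cong (E ∧_) (∧-assoc N F (isHead R p)) ⟨
  E ∧ (N ∧ F) ∧ isHead R p                ≡⟨ ∧-assoc E (N ∧ F) (isHead R p) ⟨
  (E ∧ N ∧ F) ∧ isHead R p                ∎
  where
  open ≡-Reasoning
  E = isEquivalence R
  N = not (hasFrontCrossing k R)
  F = firstAreHeads (toℕ p) R

-- All elements below p are heads, so at most one of them lies in p's block.
count-sameBlockBelow : ∀ {k} (R : Rel₂ (suc n)) p → Admissible k (toℕ p) R →
  countᶠ (λ j → (j <ᶠ p) ∧ R j p) ≡ ⟦ not (isHead R p) ⟧
count-sameBlockBelow R p adm with isHead R p in head≡
... | true = countᶠ-none (λ j → (j <ᶠ p) ∧ R j p) λ j t →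
  let j<p , jRp = T-∧⁻ (j <ᶠ p) t
  in isHead⇒Head R p (subst T (sym head≡) _) (<ᶠ⇒< j<p) jRp
... | false =
  let y , y<p , yRp = ¬Head⇒sameBlockBelow R p (λ head → subst T head≡ (Head⇒isHead R p head))
  in countᶠ-unique (λ j → (j <ᶠ p) ∧ R j p) y (T-∧⁺ (y <ᶠ p) (<⇒<ᶠ y<p) yRp) λ x t →
    let x<p , xRp = T-∧⁻ (x <ᶠ p) t
    in heads-sameBlock⇒≡ equivalence (firstHeads x (<ᶠ⇒< x<p)) (firstHeads y y<p)
         (IsEquivalence.trans equivalence xRp (IsEquivalence.sym equivalence yRp))
  where open Admissible adm

count-nonHead-fibres : ∀ k (p : Fin (suc n)) R →
  ⟦ admissible k (toℕ p) R ∧ not (isHead R p) ⟧ ≡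
  countᶠ (λ j → (j <ᶠ p) ∧ (admissible k (toℕ p) R ∧ R j p))
count-nonHead-fibres k p R with admissible k (toℕ p) R in adm≡
... | true = sym (count-sameBlockBelow R p (admissible⇒ R k (toℕ p) (subst T (sym adm≡) _)))
... | false = sym (countᶠ-none (λ j → (j <ᶠ p) ∧ (false ∧ R j p)) λ j t → proj₂ (T-∧⁻ (j <ᶠ p) t))

-- p : Fin (suc n) is the element i = toℕ p + 1 of [n + 1].
h-recurrence : ∀ k (p : Fin (suc n)) → toℕ p ℕ.< k →
  h k (suc (toℕ p)) (suc n) + toℕ p * h k (toℕ p) n ≡ h k (toℕ p) (suc n)
h-recurrence {n} k p p<k = sym (begin
  h k a (suc n)
    ≡⟨ count-∧-split (admissible k a) (λ R → isHead R p) Rs ⟩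
  count (λ R → admissible k a R ∧ isHead R p) Rs +
  count (λ R → admissible k a R ∧ not (isHead R p)) Rs
    ≡⟨ cong₂ _+_ (count-cong (λ R → sym (admissible-suc k R p)) Rs)
                 (count-fibres _ _ Rs js (count-nonHead-fibres k p)) ⟩
  h k (suc a) (suc n) + ∑ js (λ j → count (λ R → (j <ᶠ p) ∧ (admissible k a R ∧ R j p)) Rs)
    ≡⟨ cong (_+_ (h k (suc a) (suc n))) (∑-cong (λ j → count-∧ˡ (j <ᶠ p) _ Rs) js) ⟩
  h k (suc a) (suc n) + ∑ js (λ j → ⟦ j <ᶠ p ⟧ * count (λ R → admissible k a R ∧ R j p) Rs)
    ≡⟨ cong (_+_ (h k (suc a) (suc n))) (∑-⟦⟧*-const (_<ᶠ p) _ js λ j j<p →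
         Merging.count-sameBlock p j (<ᶠ⇒< j<p) k p<k) ⟩
  h k (suc a) (suc n) + countᶠ (_<ᶠ p) * h k a n
    ≡⟨ cong (λ c → h k (suc a) (suc n) + c * h k a n) (countᶠ-<ᵇ a (<⇒≤ (toℕ<n p))) ⟩
  h k (suc a) (suc n) + a * h k a n ∎)
  where
  open ≡-Reasoning
  a = toℕ p
  Rs = allRels (suc n)
  js = allFin (suc n)

+[m+n]-+n≡+m : ∀ m n → + (m + n) - + n ≡ + m
+[m+n]-+n≡+m m n = begin
  + (m + n) - + n   ≡⟨ ℤ.m-n≡m⊖n (m + n) n ⟩
  (m + n) ⊖ n       ≡⟨ ℤ.⊖-≥ (m≤n+m n m) ⟩
  + (m + n ∸ n)     ≡⟨ cong +_ (m+n∸n≡m m n) ⟩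
  + m               ∎
  where open ≡-Reasoning

lemma2p1 : (k i n : ℕ) → 2 ≤ k → 2 ≤ i → i ≤ k → i ≤ n →
    + h k i n ≡ + h k (i ∸ 1) n - + ((i ∸ 1) Data.Nat.* h k (i ∸ 1) (n ∸ 1))
lemma2p1 k (suc a) (suc n) _ _ i≤k i≤n = begin
  + h k (suc a) (suc n)
    ≡⟨ +[m+n]-+n≡+m _ (a * h k a n) ⟨
  + (h k (suc a) (suc n) + a * h k a n) - + (a * h k a n)
    ≡⟨ cong (λ c → + c - + (a * h k a n)) recurrence ⟩
  + h k a (suc n) - + (a * h k a n)
    ∎
  where
  open ≡-Reasoning
  p = fromℕ< i≤n
  recurrence : h k (suc a) (suc n) + a * h k a n ≡ h k a (suc n)
  recurrence = subst (λ t → h k (suc t) (suc n) + t * h k t n ≡ h k t (suc n)) (toℕ-fromℕ< i≤n)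
    (h-recurrence k p (subst (ℕ._< k) (sym (toℕ-fromℕ< i≤n)) i≤k))
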